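{- For all integers $n\ge 7$, if $n_1$ and $n_2$ are nonnegative integers such that $n_1+2n_2=n-5$, then $\operatorname{CS}(F(n_1,n_2),x)\preceq\operatorname{CS}(B_n,x)$.
   Context: All graphs are finite, simple and undirected. $F(n_1,n_2)$ is the graph with a central vertex $z$, two triangles $z a_1 b_1$ and $z a_2 b_2$ through $z$ (sharing only $z$), $n_1$ pendant leaves attached at $z$, and $n_2$ pendant paths $z\,x_i\,y_i$ ($i=1,\dots,n_2$) of length $2$ attached at $z$; its order is $5+n_1+2n_2$. $B_n$ is the graph with vertices $c,a,b,w$ and $n-4$ further vertices, where $c$ is adjacent to all other vertices and the only other edges are $ab$ and $aw$. A connected set is a vertex subset inducing a connected subgraph; $S_k(G)$ is the number of connected sets of size $k$ and $\operatorname{CS}(G,x)=\sum_{k\ge1}S_k(G)x^k$. For polynomials $A(x)=\sum_{k=0}^n a_kx^k$, $B(x)=\sum_{k=0}^m b_kx^k$, write $B(x)\preceq A(x)$ if $m\le n$ and $b_k\le a_k$ for all $k$. -}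

module Defs where

open import Data.Nat using (ℕ; zero; suc; _+_; _*_; _∸_; _≡ᵇ_; _≤_)
open import Data.Bool using (Bool; true; false; _∧_; _∨_; not; if_then_else_)
open import Data.Fin using (Fin; toℕ)
open import Data.Fin.Subset using (Subset; ∣_∣)
open import Data.Vec using (Vec; []; _∷_; lookup; tabulate)
open import Data.List using (List; []; _∷_; _++_; map; upTo; concatMap; length; filterᵇ)
open import Data.Bool.ListAction using (any; all)
open import Data.Product using (_×_; _,_)

-- Adjacency is the
-- symmetric closure; all edge lists below are loop-free and refer only
-- to labels < n, so the resulting graph is simple.

record Graph : Set where
  constructor mkGraph
  field
    order : ℕ
    adj   : Fin order → Fin order → Bool
open Graph public

edgeAdj : (n : ℕ) → List (ℕ × ℕ) → Fin n → Fin n → Bool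
edgeAdj n es u v =
  any (λ { (i , j) → ((i ≡ᵇ toℕ u) ∧ (j ≡ᵇ toℕ v)) ∨ ((i ≡ᵇ toℕ v) ∧ (j ≡ᵇ toℕ u)) }) es

fromEdges : (n : ℕ) → List (ℕ × ℕ) → Graph
fromEdges n es = mkGraph n (edgeAdj n es)

-- F(n₁,n₂): labels  z = 0, a₁ = 1, b₁ = 2, a₂ = 3, b₂ = 4,
-- pendant leaves 5, …, 4+n₁,
-- pendant paths z x_i y_i with x_i = 5+n₁+2i, y_i = 6+n₁+2i (i < n₂).
-- Order 5 + n₁ + 2 n₂.

F-edges : ℕ → ℕ → List (ℕ × ℕ)
F-edges n₁ n₂ =
  ((0 , 1) ∷ (0 , 2) ∷ (1 , 2) ∷ (0 , 3) ∷ (0 , 4) ∷ (3 , 4) ∷ [])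
  ++ map (λ i → (0 , 5 + i)) (upTo n₁)
  ++ concatMap (λ i → (0 , 5 + n₁ + 2 * i) ∷ (5 + n₁ + 2 * i , 6 + n₁ + 2 * i) ∷ []) (upTo n₂)

F : ℕ → ℕ → Graph
F n₁ n₂ = fromEdges (5 + n₁ + 2 * n₂) (F-edges n₁ n₂)

-- B_n: labels c = 0, a = 1, b = 2, w = 3, further vertices 4, …, n-1;
-- c adjacent to all other vertices, plus the edges ab and aw.

B-edges : ℕ → List (ℕ × ℕ)
B-edges n = map (λ i → (0 , suc i)) (upTo (n ∸ 1)) ++ ((1 , 2) ∷ (1 , 3) ∷ [])

B : ℕ → Graph
B n = fromEdges n (B-edges n)

-- Reachability is computed by iterating the
-- "add all S-neighbours" step  order G  times (enough for a graph on
-- order G vertices).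

module _ (G : Graph) where
  private
    n = order G

  vertices : List (Fin n)
  vertices = Data.List.allFin n
    where import Data.List

  step : Subset n → Subset n → Subset n
  step S R = tabulate λ v →
    lookup R v ∨ (lookup S v ∧ any (λ u → lookup R u ∧ adj G u v) vertices)

  iter : ℕ → Subset n → Subset n → Subset n
  iter zero    S R = R
  iter (suc t) S R = iter t S (step S R)

  firstOf : Subset n → Subset n
  firstOf S = tabulate λ v →
    lookup S v ∧ all (λ u → not (lookup S u) ∨ (toℕ v Data.Nat.≤ᵇ toℕ u)) vertices
    where import Data.Nat

  isConnectedSet : Subset n → Bool
  isConnectedSet S =
    any (lookup S) vertices ∧
    all (λ v → not (lookup S v) ∨ lookup (iter n S (firstOf S)) v) vertices

allSubsets : (n : ℕ) → List (Subset n)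
allSubsets zero    = [] ∷ []
allSubsets (suc n) = map (true ∷_) (allSubsets n) ++ map (false ∷_) (allSubsets n)

-- S_k(G): number of connected sets of size k; these are the coefficients
-- of CS(G,x) = Σ_{k≥1} S_k(G) x^k.
S : Graph → ℕ → ℕ
S G k = length (filterᵇ (λ X → isConnectedSet G X ∧ (∣ X ∣ ≡ᵇ k)) (allSubsets (order G)))

degCS : Graph → ℕ
degCS G = go (order G)
  where
  go : ℕ → ℕ
  go zero    = 0
  go (suc k) = if S G (suc k) ≡ᵇ 0 then go k else suc k

_⪯CS_ : Graph → Graph → Set
H ⪯CS G = (degCS H ≤ degCS G) × (∀ k → S H k ≤ S G k)

-- Both graphs have n vertices and are connected, so both polynomials have degree n, and
-- S₀ = 0, S₁ = n for each.  A connected 2-set is the vertex set of an edge: F(n₁,n₂) has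
-- n + 1 edges, and B_n has n + 1 connected 2-sets (the n − 1 sets containing c, and {a,b},
-- {a,w}).  For k ≥ 3 both counts are compared with the number of k-sets containing vertex 0
-- (z, resp. c): F − z induces a matching, whose connected sets have at most two vertices, so
-- every connected k-set of F contains z; in B_n every set containing c is connected.
module Submission where

open import Defs
open import Data.Nat using (ℕ; zero; suc; _+_; _*_; _∸_; _≤_; _<_; _<?_; _≡ᵇ_; z≤n; s≤s)
open import Data.Nat.Properties
open import Data.Bool using (Bool; true; false; _∧_; _∨_; not; T; if_then_else_)
open import Data.Bool.Properties using (T-∧; T-∨; T-≡)
open import Data.Bool.ListAction using (any; all)
open import Data.List using (List; []; _∷_; _++_; map; concatMap; length; filterᵇ; upTo)
open import Data.List.Properties using (length-++; length-map; length-upTo; filter-++)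
open import Data.List.Membership.Propositional using (find; lose) renaming (_∈_ to _∈ₗ_)
open import Data.List.Membership.Propositional.Properties
  using (∈-allFin; ∈-++⁺ˡ; ∈-++⁺ʳ; ∈-++⁻; ∈-map⁺; ∈-map⁻; ∈-upTo⁺; ∈-concatMap⁺; ∈-concatMap⁻)
open import Data.List.Relation.Unary.Any using (here; there)
open import Data.List.Relation.Unary.Any.Properties using (any⁺; any⁻)
import Data.List.Relation.Unary.All as All
open import Data.List.Relation.Unary.All.Properties using (all⁺; all⁻)
open import Data.Vec using ([]; _∷_; here; there; lookup; tabulate)
open import Data.Vec.Properties using (lookup∘tabulate; []=⇒lookup; lookup⇒[]=)
open import Data.Vec.Relation.Binary.Equality.DecPropositional Data.Bool._≟_ using (_≡?_)
open import Data.Fin using (Fin; zero; suc; toℕ; fromℕ<)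
import Data.Fin.Properties as Fin
open import Data.Fin.Properties using (toℕ-injective; toℕ<n; toℕ-fromℕ<) renaming (_≟_ to _≟ᶠ_)
open import Data.Fin.Subset using (Subset; _∈_; _∉_; _⊆_; _-_; _∪_; ∣_∣; Nonempty; ⁅_⁆; ⊥; ⊤)
open import Data.Fin.Subset.Properties
  using (⊆-antisym; ∉⊥; ∈⊤; ∣⊥∣≡0; ∣⊤∣≡n; ∣⁅x⁆∣≡1; ∣p∣≤∣x∷p∣; x∈⁅x⁆; x∈p∪q⁺; p⊆q⇒∣p∣≤∣q∣;
         p─q⊆p; x∈p∧x≢y⇒x∈p-y; x∈p⇒∣p-x∣<∣p∣)
open import Data.Product using (∃; _×_; _,_; proj₁; proj₂)
open import Data.Sum using (_⊎_; inj₁; inj₂; [_,_]′; swap; fromInj₂)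
import Data.Sum as Sum
import Data.Empty as Empty
open import Function using (_∘_; Equivalence)
open Equivalence using (to; from)
open import Relation.Binary.PropositionalEquality
open import Relation.Binary.Definitions using (Symmetric)
open import Relation.Nullary using (¬_; yes; no; contradiction)
open import Relation.Nullary.Decidable using (Dec; T?; does; dec-true)

pattern 4+ m = suc (suc (suc (suc m)))

T-not-∨⁺ : ∀ {a b} → (T a → T b) → T (not a ∨ b)
T-not-∨⁺ {true}  f = f _
T-not-∨⁺ {false} f = _

T-not-∨⁻ : ∀ {a b} → T (not a ∨ b) → T a → T b
T-not-∨⁻ {true} t _ = t

T-does⁺ : ∀ {A : Set} (a? : Dec A) → A → T (does a?)
T-does⁺ a? a = from T-≡ (dec-true a? a)

T-does⁻ : ∀ {A : Set} (a? : Dec A) → T (does a?) → A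
T-does⁻ (yes a) _ = a

module _ {n : ℕ} where

  ∈⇒T-lookup : ∀ {X : Subset n} {v} → v ∈ X → T (lookup X v)
  ∈⇒T-lookup v∈X = from T-≡ ([]=⇒lookup v∈X)

  T-lookup⇒∈ : ∀ {X : Subset n} {v} → T (lookup X v) → v ∈ X
  T-lookup⇒∈ {X} {v} t = lookup⇒[]= v X (to T-≡ t)

  ∈-tabulate⁺ : ∀ {f : Fin n → Bool} {v} → T (f v) → v ∈ tabulate f
  ∈-tabulate⁺ {f} {v} t = T-lookup⇒∈ (subst T (sym (lookup∘tabulate f v)) t)

  ∈-tabulate⁻ : ∀ {f : Fin n → Bool} {v} → v ∈ tabulate f → T (f v)
  ∈-tabulate⁻ {f} {v} v∈ = subst T (lookup∘tabulate f v) (∈⇒T-lookup v∈)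

x∉p-x : ∀ {n} (p : Subset n) x → x ∉ p - x
x∉p-x (_ ∷ p) (suc x) (there x∈p-x) = x∉p-x p x x∈p-x

x∈p-y⇒x≢y : ∀ {n} {p : Subset n} {x y} → x ∈ p - y → x ≢ y
x∈p-y⇒x≢y {p = p} {y = y} x∈p-y refl = x∉p-x p y x∈p-y

x∈p⇒0<∣p∣ : ∀ {n} {p : Subset n} {x} → x ∈ p → 0 < ∣ p ∣
x∈p⇒0<∣p∣ x∈p = ≤-trans (s≤s z≤n) (x∈p⇒∣p-x∣<∣p∣ x∈p)

0<∣p∣⇒Nonempty : ∀ {n} (p : Subset n) → 0 < ∣ p ∣ → Nonempty p
0<∣p∣⇒Nonempty (true  ∷ p) _     = zero , here
0<∣p∣⇒Nonempty (false ∷ p) 0<∣p∣ with x , x∈p ← 0<∣p∣⇒Nonempty p 0<∣p∣ = suc x , there x∈p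

∣p∪q∣≤∣p∣+∣q∣ : ∀ {n} (p q : Subset n) → ∣ p ∪ q ∣ ≤ ∣ p ∣ + ∣ q ∣
∣p∪q∣≤∣p∣+∣q∣ []          []          = z≤n
∣p∪q∣≤∣p∣+∣q∣ (true  ∷ p) (b     ∷ q) =
  s≤s (≤-trans (∣p∪q∣≤∣p∣+∣q∣ p q) (+-monoʳ-≤ ∣ p ∣ (∣p∣≤∣x∷p∣ b q)))
∣p∪q∣≤∣p∣+∣q∣ (false ∷ p) (true  ∷ q) =
  ≤-trans (s≤s (∣p∪q∣≤∣p∣+∣q∣ p q)) (≤-reflexive (sym (+-suc ∣ p ∣ ∣ q ∣)))
∣p∪q∣≤∣p∣+∣q∣ (false ∷ p) (false ∷ q) = ∣p∪q∣≤∣p∣+∣q∣ p q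

∣p∣≤1+∣p-x∣ : ∀ {n} (p : Subset n) x → ∣ p ∣ ≤ suc ∣ p - x ∣
∣p∣≤1+∣p-x∣ p x = begin
  ∣ p ∣                   ≤⟨ p⊆q⇒∣p∣≤∣q∣ p⊆x∪p-x ⟩
  ∣ ⁅ x ⁆ ∪ (p - x) ∣     ≤⟨ ∣p∪q∣≤∣p∣+∣q∣ ⁅ x ⁆ (p - x) ⟩
  ∣ ⁅ x ⁆ ∣ + ∣ p - x ∣   ≡⟨ cong (_+ ∣ p - x ∣) (∣⁅x⁆∣≡1 x) ⟩
  suc ∣ p - x ∣           ∎
  where
  open ≤-Reasoning
  p⊆x∪p-x : p ⊆ ⁅ x ⁆ ∪ (p - x)
  p⊆x∪p-x {y} y∈p with y ≟ᶠ x
  ... | yes refl = x∈p∪q⁺ (inj₁ (x∈⁅x⁆ x))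
  ... | no  y≢x  = x∈p∪q⁺ (inj₂ (x∈p∧x≢y⇒x∈p-y y∈p y≢x))

∣p∣≤1⇒subsingleton : ∀ {n} {p : Subset n} → ∣ p ∣ ≤ 1 → ∀ {x y} → x ∈ p → y ∈ p → y ≡ x
∣p∣≤1⇒subsingleton {p = p} ∣p∣≤1 {x} {y} x∈p y∈p with y ≟ᶠ x
... | yes y≡x = y≡x
... | no  y≢x = contradiction (≤-trans (x∈p⇒0<∣p∣ y∈p-x) (≤-pred ∣p-x∣<1)) (<-irrefl refl)
  where
  y∈p-x : y ∈ p - x
  y∈p-x = x∈p∧x≢y⇒x∈p-y y∈p y≢x
  ∣p-x∣<1 : ∣ p - x ∣ < 1
  ∣p-x∣<1 = ≤-trans (x∈p⇒∣p-x∣<∣p∣ x∈p) ∣p∣≤1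

subsingleton⇒∣p∣≤1 : ∀ {n} (p : Subset n) → (∀ {x y} → x ∈ p → y ∈ p → x ≡ y) → ∣ p ∣ ≤ 1
subsingleton⇒∣p∣≤1 []          _ = z≤n
subsingleton⇒∣p∣≤1 (true  ∷ p) h = s≤s (≮⇒≥ p-empty)
  where
  p-empty : ¬ 0 < ∣ p ∣
  p-empty 0<∣p∣ with x , x∈p ← 0<∣p∣⇒Nonempty p 0<∣p∣ = Fin.0≢1+n (h here (there x∈p))
subsingleton⇒∣p∣≤1 (false ∷ p) h =
  subsingleton⇒∣p∣≤1 p λ x∈p y∈p → Fin.suc-injective (h (there x∈p) (there y∈p))

∣p∣≡2⇒pair : ∀ {n} {p : Subset n} {x} → ∣ p ∣ ≡ 2 → x ∈ p →
             ∃ λ y → y ∈ p × y ≢ x × (∀ {z} → z ∈ p → z ≡ x ⊎ z ≡ y)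
∣p∣≡2⇒pair {p = p} {x} ∣p∣≡2 x∈p
  with y , y∈p-x ← 0<∣p∣⇒Nonempty (p - x) (≤-pred (subst (_≤ suc ∣ p - x ∣) ∣p∣≡2 (∣p∣≤1+∣p-x∣ p x))) =
  y , p─q⊆p p ⁅ x ⁆ y∈p-x , x∈p-y⇒x≢y y∈p-x , x-or-y
  where
  ∣p-x∣≤1 : ∣ p - x ∣ ≤ 1
  ∣p-x∣≤1 = ≤-pred (subst (∣ p - x ∣ <_) ∣p∣≡2 (x∈p⇒∣p-x∣<∣p∣ x∈p))
  x-or-y : ∀ {z} → z ∈ p → z ≡ x ⊎ z ≡ y
  x-or-y {z} z∈p with z ≟ᶠ x
  ... | yes z≡x = inj₁ z≡x
  ... | no  z≢x = inj₂ (∣p∣≤1⇒subsingleton ∣p-x∣≤1 y∈p-x (x∈p∧x≢y⇒x∈p-y z∈p z≢x))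

Least : ∀ {n} → Subset n → Fin n → Set
Least X v = v ∈ X × (∀ {u} → u ∈ X → toℕ v ≤ toℕ u)

Least-unique : ∀ {n} {X : Subset n} {u v} → Least X u → Least X v → u ≡ v
Least-unique (u∈X , u-least) (v∈X , v-least) = toℕ-injective (≤-antisym (u-least v∈X) (v-least u∈X))

containsZero : ∀ {n} → Subset n → Bool
containsZero []      = false
containsZero (b ∷ _) = b

count : {A : Set} → (A → Bool) → List A → ℕ
count p xs = length (filterᵇ p xs)

module _ {A : Set} where

  count-mono : {p q : A → Bool} → (∀ {x} → T (p x) → T (q x)) → ∀ xs → count p xs ≤ count q xs
  count-mono         p⇒q []       = z≤n
  count-mono {p} {q} p⇒q (x ∷ xs) with p x in px | q x in qx
  ... | true  | true  = s≤s (count-mono p⇒q xs)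
  ... | true  | false = Empty.⊥-elim (subst T qx (p⇒q (subst T (sym px) _)))
  ... | false | true  = m≤n⇒m≤1+n (count-mono p⇒q xs)
  ... | false | false = count-mono p⇒q xs

  count-∨ : ∀ (p q : A → Bool) xs → count (λ x → p x ∨ q x) xs ≤ count p xs + count q xs
  count-∨ p q []       = z≤n
  count-∨ p q (x ∷ xs) with p x | q x
  ... | true  | true  = s≤s (≤-trans (count-∨ p q xs) (+-monoʳ-≤ (count p xs) (n≤1+n _)))
  ... | true  | false = s≤s (count-∨ p q xs)
  ... | false | true  = ≤-trans (s≤s (count-∨ p q xs)) (≤-reflexive (sym (+-suc _ _)))
  ... | false | false = count-∨ p q xs

  count-∨-disjoint : ∀ {p q : A → Bool} → (∀ x → T (p x) → T (q x) → Empty.⊥) →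
                     ∀ xs → count p xs + count q xs ≤ count (λ x → p x ∨ q x) xs
  count-∨-disjoint         disjoint []       = z≤n
  count-∨-disjoint {p} {q} disjoint (x ∷ xs) with p x in px | q x in qx
  ... | true  | true  = Empty.⊥-elim (disjoint x (subst T (sym px) _) (subst T (sym qx) _))
  ... | true  | false = s≤s (count-∨-disjoint disjoint xs)
  ... | false | true  = ≤-trans (≤-reflexive (+-suc _ _)) (s≤s (count-∨-disjoint disjoint xs))
  ... | false | false = count-∨-disjoint disjoint xs

  count-++ : ∀ (p : A → Bool) xs ys → count p (xs ++ ys) ≡ count p xs + count p ys
  count-++ p xs ys = trans (cong length (filter-++ (T? ∘ p) xs ys)) (length-++ (filterᵇ p xs))

  count-map : ∀ {B : Set} (p : A → Bool) (f : B → A) xs → count p (map f xs) ≡ count (p ∘ f) xs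
  count-map p f []       = refl
  count-map p f (x ∷ xs) with p (f x)
  ... | true  = cong suc (count-map p f xs)
  ... | false = count-map p f xs

  count-false : ∀ xs → count (λ (_ : A) → false) xs ≡ 0
  count-false []       = refl
  count-false (_ ∷ xs) = count-false xs

  count-any≤length : ∀ {E : Set} (p : A → E → Bool) es xs →
                     (∀ e → count (λ x → p x e) xs ≤ 1) → count (λ x → any (p x) es) xs ≤ length es
  count-any≤length p []       xs _  = ≤-reflexive (count-false xs)
  count-any≤length p (e ∷ es) xs ≤1 = ≤-trans (count-∨ (λ x → p x e) (λ x → any (p x) es) xs)
                                             (+-mono-≤ (≤1 e) (count-any≤length p es xs ≤1))

countSubsets : (n : ℕ) → (Subset n → Bool) → ℕ
countSubsets n P = count P (allSubsets n)

countSubsets-suc : ∀ n (P : Subset (suc n) → Bool) →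
  countSubsets (suc n) P ≡ countSubsets n (P ∘ (true ∷_)) + countSubsets n (P ∘ (false ∷_))
countSubsets-suc n P = begin
  count P (map (true ∷_) (allSubsets n) ++ map (false ∷_) (allSubsets n))
    ≡⟨ count-++ P (map (true ∷_) (allSubsets n)) _ ⟩
  count P (map (true ∷_) (allSubsets n)) + count P (map (false ∷_) (allSubsets n))
    ≡⟨ cong₂ _+_ (count-map P (true ∷_) (allSubsets n)) (count-map P (false ∷_) (allSubsets n)) ⟩
  countSubsets n (P ∘ (true ∷_)) + countSubsets n (P ∘ (false ∷_))
    ∎
  where open ≡-Reasoning

countSubsets-mono : ∀ n {P Q : Subset n → Bool} → (∀ {X} → T (P X) → T (Q X)) →
                    countSubsets n P ≤ countSubsets n Q
countSubsets-mono n P⇒Q = count-mono P⇒Q (allSubsets n)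

countSubsets-∨-disjoint : ∀ n {P Q : Subset n → Bool} → (∀ X → T (P X) → T (Q X) → Empty.⊥) →
                          countSubsets n P + countSubsets n Q ≤ countSubsets n (λ X → P X ∨ Q X)
countSubsets-∨-disjoint n disjoint = count-∨-disjoint disjoint (allSubsets n)

countSubsets-false : ∀ n → countSubsets n (λ _ → false) ≡ 0
countSubsets-false n = count-false (allSubsets n)

countSubsets-≡? : ∀ {n} (Y : Subset n) → countSubsets n (λ X → does (X ≡? Y)) ≡ 1
countSubsets-≡?         []          = refl
countSubsets-≡? {suc n} (true  ∷ Y) =
  trans (countSubsets-suc n _) (cong₂ _+_ (countSubsets-≡? Y) (countSubsets-false n))
countSubsets-≡? {suc n} (false ∷ Y) =
  trans (countSubsets-suc n _) (cong₂ _+_ (countSubsets-false n) (countSubsets-≡? Y))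

countSubsets-witness : ∀ {n} {P : Subset n → Bool} (Y : Subset n) → T (P Y) → 0 < countSubsets n P
countSubsets-witness {n} {P} Y PY = begin
  1                                      ≡⟨ sym (countSubsets-≡? Y) ⟩
  countSubsets n (λ X → does (X ≡? Y))   ≤⟨ countSubsets-mono n (λ {X} → X≡Y⇒P {X}) ⟩
  countSubsets n P                       ∎
  where
  open ≤-Reasoning
  X≡Y⇒P : ∀ {X} → T (does (X ≡? Y)) → T (P X)
  X≡Y⇒P {X} X≡Y = subst (T ∘ P) (sym (T-does⁻ (X ≡? Y) X≡Y)) PY

countSubsets-∣∣≡0 : ∀ n → countSubsets n (λ X → ∣ X ∣ ≡ᵇ 0) ≡ 1
countSubsets-∣∣≡0 zero    = refl
countSubsets-∣∣≡0 (suc n) =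
  trans (countSubsets-suc n _) (cong₂ _+_ (countSubsets-false n) (countSubsets-∣∣≡0 n))

countSubsets-∣∣≡1 : ∀ n → countSubsets n (λ X → ∣ X ∣ ≡ᵇ 1) ≡ n
countSubsets-∣∣≡1 zero    = refl
countSubsets-∣∣≡1 (suc n) =
  trans (countSubsets-suc n _) (cong₂ _+_ (countSubsets-∣∣≡0 n) (countSubsets-∣∣≡1 n))

countSubsets-containsZero∧∣∣≡2 : ∀ n → countSubsets (suc n) (λ X → containsZero X ∧ (∣ X ∣ ≡ᵇ 2)) ≡ n
countSubsets-containsZero∧∣∣≡2 n = begin
  countSubsets (suc n) (λ X → containsZero X ∧ (∣ X ∣ ≡ᵇ 2))
    ≡⟨ countSubsets-suc n _ ⟩
  countSubsets n (λ X → ∣ X ∣ ≡ᵇ 1) + countSubsets n (λ _ → false)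
    ≡⟨ cong₂ _+_ (countSubsets-∣∣≡1 n) (countSubsets-false n) ⟩
  n + 0
    ≡⟨ +-identityʳ n ⟩
  n ∎
  where open ≡-Reasoning

-- Connected sets

module _ (G : Graph) where

  private
    n = order G

  T-any-vertices⁺ : ∀ {p : Fin n → Bool} v → T (p v) → T (any p (vertices G))
  T-any-vertices⁺ {p} v pv = any⁺ p (lose (∈-allFin v) pv)

  T-any-vertices⁻ : ∀ {p : Fin n → Bool} → T (any p (vertices G)) → ∃ λ v → T (p v)
  T-any-vertices⁻ {p} t with v , _ , pv ← find (any⁻ p (vertices G) t) = v , pv

  T-all-vertices⁺ : ∀ {p : Fin n → Bool} → (∀ v → T (p v)) → T (all p (vertices G))
  T-all-vertices⁺ {p} h = all⁻ p {vertices G} (All.tabulate λ {v} _ → h v)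

  T-all-vertices⁻ : ∀ {p : Fin n → Bool} → T (all p (vertices G)) → ∀ v → T (p v)
  T-all-vertices⁻ {p} t v = All.lookup (all⁺ p (vertices G) t) (∈-allFin v)

  ∈-step⁺ˡ : ∀ (S : Subset n) {R v} → v ∈ R → v ∈ step G S R
  ∈-step⁺ˡ S v∈R = ∈-tabulate⁺ (from T-∨ (inj₁ (∈⇒T-lookup v∈R)))

  ∈-step⁺ʳ : ∀ {S R : Subset n} {u v} → v ∈ S → u ∈ R → T (adj G u v) → v ∈ step G S R
  ∈-step⁺ʳ {u = u} v∈S u∈R uv = ∈-tabulate⁺ (from T-∨ (inj₂ (from T-∧
    (∈⇒T-lookup v∈S , T-any-vertices⁺ u (from T-∧ (∈⇒T-lookup u∈R , uv))))))

  ∈-step⁻ : ∀ {S R : Subset n} {v} → v ∈ step G S R →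
            v ∈ R ⊎ (v ∈ S × ∃ λ u → u ∈ R × T (adj G u v))
  ∈-step⁻ v∈step with to T-∨ (∈-tabulate⁻ v∈step)
  ... | inj₁ v∈R = inj₁ (T-lookup⇒∈ v∈R)
  ... | inj₂ t with v∈S , ∃u ← to T-∧ t with u , u∈R∧uv ← T-any-vertices⁻ ∃u with u∈R , uv ← to T-∧ u∈R∧uv =
    inj₂ (T-lookup⇒∈ v∈S , u , T-lookup⇒∈ u∈R , uv)

  R⊆iter : ∀ t {S R : Subset n} → R ⊆ iter G t S R
  R⊆iter zero        v∈R = v∈R
  R⊆iter (suc t) {S} v∈R = R⊆iter t (∈-step⁺ˡ S v∈R)

  iter-+ : ∀ a b (S R : Subset n) → iter G (a + b) S R ≡ iter G b S (iter G a S R)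
  iter-+ zero    b S R = refl
  iter-+ (suc a) b S R = iter-+ a b S (step G S R)

  iter-mono : ∀ {s t} → s ≤ t → ∀ {S R : Subset n} → iter G s S R ⊆ iter G t S R
  iter-mono {s} {t} s≤t {S} {R} v∈iter =
    subst (_ ∈_) (trans (sym (iter-+ s (t ∸ s) S R)) (cong (λ k → iter G k S R) (m+[n∸m]≡n s≤t)))
          (R⊆iter (t ∸ s) v∈iter)

  iter-induction : ∀ (S R : Subset n) (C : Fin n → Set) →
                   (∀ {v} → v ∈ R → C v) →
                   (∀ {u v} → C u → v ∈ S → T (adj G u v) → C v) →
                   ∀ t {v} → v ∈ iter G t S R → C v
  iter-induction S R C base closed zero    v∈R = base v∈R
  iter-induction S R C base closed (suc t) = iter-induction S (step G S R) C base′ closed t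
    where
    base′ : ∀ {v} → v ∈ step G S R → C v
    base′ v∈step with ∈-step⁻ v∈step
    ... | inj₁ v∈R                  = base v∈R
    ... | inj₂ (v∈S , u , u∈R , uv) = closed (base u∈R) v∈S uv

  Least⇒∈-firstOf : ∀ {X : Subset n} {v} → Least X v → v ∈ firstOf G X
  Least⇒∈-firstOf (v∈X , least) = ∈-tabulate⁺ (from T-∧ (∈⇒T-lookup v∈X ,
    T-all-vertices⁺ λ u → T-not-∨⁺ λ u∈X → ≤⇒≤ᵇ (least (T-lookup⇒∈ u∈X))))

  ∈-firstOf⇒Least : ∀ {X : Subset n} {v} → v ∈ firstOf G X → Least X v
  ∈-firstOf⇒Least {v = v} v∈first with v∈X , least ← to T-∧ (∈-tabulate⁻ v∈first) =
    T-lookup⇒∈ v∈X , λ {u} u∈X → ≤ᵇ⇒≤ (toℕ v) (toℕ u) (T-not-∨⁻ (T-all-vertices⁻ least u) (∈⇒T-lookup u∈X))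

  isConnectedSet⁺ : ∀ {X : Subset n} → Nonempty X → X ⊆ iter G n X (firstOf G X) → T (isConnectedSet G X)
  isConnectedSet⁺ (v , v∈X) X⊆reached = from T-∧
    (T-any-vertices⁺ v (∈⇒T-lookup v∈X) , T-all-vertices⁺ λ u → T-not-∨⁺ (∈⇒T-lookup ∘ X⊆reached ∘ T-lookup⇒∈))

  isConnectedSet⁻ : ∀ {X : Subset n} → T (isConnectedSet G X) → Nonempty X × X ⊆ iter G n X (firstOf G X)
  isConnectedSet⁻ connected with nonempty , reached ← to T-∧ connected with v , v∈X ← T-any-vertices⁻ nonempty =
    (v , T-lookup⇒∈ v∈X) , λ {u} u∈X → T-lookup⇒∈ (T-not-∨⁻ (T-all-vertices⁻ reached u) (∈⇒T-lookup u∈X))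

  connected-induction : ∀ {X : Subset n} → T (isConnectedSet G X) → (C : Fin n → Set) →
                        (∀ {v} → Least X v → C v) →
                        (∀ {u v} → u ∈ X → v ∈ X → C u → T (adj G u v) → C v) →
                        ∀ {v} → v ∈ X → C v
  connected-induction {X} connected C base closed v∈X =
    proj₂ (iter-induction X (firstOf G X) (λ v → v ∈ X × C v)
             (λ v∈first → let least = ∈-firstOf⇒Least v∈first in proj₁ least , base least)
             (λ (u∈X , Cu) v∈X uv → v∈X , closed u∈X v∈X Cu uv)
             n (proj₂ (isConnectedSet⁻ connected) v∈X))

  connected⇒∃Least : ∀ {X : Subset n} → T (isConnectedSet G X) → ∃ (Least X)
  connected⇒∃Least {X} connected with v , v∈X ← proj₁ (isConnectedSet⁻ connected) =
    connected-induction connected (λ _ → ∃ (Least X)) (λ least → _ , least) (λ _ _ ∃least _ → ∃least) v∈X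

  connected-pair⇒adj : ∀ {X : Subset n} {m b} → T (isConnectedSet G X) → Least X m → b ∈ X → b ≢ m →
                       (∀ {z} → z ∈ X → z ≡ m ⊎ z ≡ b) → T (adj G m b)
  connected-pair⇒adj {X} {m} {b} connected least b∈X b≢m m-or-b =
    fromInj₂ (λ b≡m → contradiction b≡m b≢m)
             (connected-induction connected _ (λ least′ → inj₁ (Least-unique least′ least)) closed b∈X)
    where
    closed : ∀ {u v} → u ∈ X → v ∈ X → u ≡ m ⊎ T (adj G m b) → T (adj G u v) → v ≡ m ⊎ T (adj G m b)
    closed _ _   (inj₂ mb)   _  = inj₂ mb
    closed _ v∈X (inj₁ refl) uv with m-or-b v∈X
    ... | inj₁ v≡m  = inj₁ v≡m
    ... | inj₂ refl = inj₂ uv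

  connected⇒0<∣X∣ : ∀ {X : Subset n} → T (isConnectedSet G X) → 0 < ∣ X ∣
  connected⇒0<∣X∣ connected = x∈p⇒0<∣p∣ (proj₂ (proj₁ (isConnectedSet⁻ connected)))

  connected-within : ∀ t → t ≤ n → ∀ {X : Subset n} → Nonempty X → X ⊆ iter G t X (firstOf G X) →
                     T (isConnectedSet G X)
  connected-within t t≤n nonempty X⊆reached = isConnectedSet⁺ nonempty (iter-mono t≤n ∘ X⊆reached)

  star-connected : ∀ {X : Subset n} {v} → Least X v → (∀ {u} → u ∈ X → u ≢ v → T (adj G v u)) →
                   T (isConnectedSet G X)
  star-connected {X} {v} least adjacent =
    connected-within 1 (≤-trans (s≤s z≤n) (toℕ<n v)) (v , proj₁ least) X⊆step
    where
    X⊆step : X ⊆ step G X (firstOf G X)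
    X⊆step {u} u∈X with u ≟ᶠ v
    ... | yes refl = ∈-step⁺ˡ X (Least⇒∈-firstOf least)
    ... | no  u≢v  = ∈-step⁺ʳ u∈X (Least⇒∈-firstOf least) (adjacent u∈X u≢v)

  depth-two-connected : 2 ≤ n → ∀ {X : Subset n} {v} → Least X v →
    (∀ {u} → u ∈ X → u ≡ v ⊎ T (adj G v u) ⊎ ∃ λ w → w ∈ X × T (adj G v w) × T (adj G w u)) →
    T (isConnectedSet G X)
  depth-two-connected 2≤n {X} {v} least near = connected-within 2 2≤n (v , proj₁ least) X⊆step²
    where
    v∈first : v ∈ firstOf G X
    v∈first = Least⇒∈-firstOf least
    X⊆step² : X ⊆ step G X (step G X (firstOf G X))
    X⊆step² u∈X with near u∈X
    ... | inj₁ refl                       = ∈-step⁺ˡ X (∈-step⁺ˡ X v∈first)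
    ... | inj₂ (inj₁ vu)                  = ∈-step⁺ˡ X (∈-step⁺ʳ u∈X v∈first vu)
    ... | inj₂ (inj₂ (w , w∈X , vw , wu)) = ∈-step⁺ʳ u∈X (∈-step⁺ʳ w∈X v∈first vw) wu

  edge-connected : ∀ {X : Subset n} {x y} → x ∈ X → toℕ x ≤ toℕ y → (∀ {z} → z ∈ X → z ≡ x ⊎ z ≡ y) →
                   T (adj G x y) → T (isConnectedSet G X)
  edge-connected {X} {x} x∈X x≤y x-or-y xy = star-connected (x∈X , least) adjacent
    where
    least : ∀ {z} → z ∈ X → toℕ x ≤ toℕ z
    least z∈X with x-or-y z∈X
    ... | inj₁ refl = ≤-refl
    ... | inj₂ refl = x≤y
    adjacent : ∀ {z} → z ∈ X → z ≢ x → T (adj G x z)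
    adjacent z∈X z≢x with x-or-y z∈X
    ... | inj₁ z≡x  = contradiction z≡x z≢x
    ... | inj₂ refl = xy

  singleton-connected : ∀ {X : Subset n} → ∣ X ∣ ≡ 1 → T (isConnectedSet G X)
  singleton-connected {X} ∣X∣≡1 with v , v∈X ← 0<∣p∣⇒Nonempty X (≤-reflexive (sym ∣X∣≡1)) =
    star-connected (v∈X , ≤-reflexive ∘ cong toℕ ∘ sym ∘ ≡v) (λ u∈X u≢v → contradiction (≡v u∈X) u≢v)
    where
    ≡v : ∀ {u} → u ∈ X → u ≡ v
    ≡v = ∣p∣≤1⇒subsingleton (≤-reflexive ∣X∣≡1) v∈X

  S≤countSubsets : ∀ k {Q : Subset n → Bool} →
                   (∀ X → T (isConnectedSet G X) → ∣ X ∣ ≡ k → T (Q X)) → S G k ≤ countSubsets n Q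
  S≤countSubsets k h = countSubsets-mono n λ {X} t →
    let connected , ∣X∣≡k = to T-∧ t in h X connected (≡ᵇ⇒≡ ∣ X ∣ k ∣X∣≡k)

  countSubsets≤S : ∀ k {Q : Subset n → Bool} →
                   (∀ X → T (Q X) → T (isConnectedSet G X) × ∣ X ∣ ≡ k) → countSubsets n Q ≤ S G k
  countSubsets≤S k h = countSubsets-mono n λ {X} QX →
    let connected , ∣X∣≡k = h X QX in from T-∧ (connected , ≡⇒≡ᵇ ∣ X ∣ k ∣X∣≡k)

  S-zero : S G 0 ≡ 0
  S-zero = n≤0⇒n≡0 (≤-trans (S≤countSubsets 0 {λ _ → false} λ _ connected ∣X∣≡0 →
                               <-irrefl (sym ∣X∣≡0) (connected⇒0<∣X∣ connected))
                            (≤-reflexive (countSubsets-false n)))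

  S-one : S G 1 ≡ n
  S-one = ≤-antisym
    (≤-trans (S≤countSubsets 1 λ X _ ∣X∣≡1 → ≡⇒≡ᵇ ∣ X ∣ 1 ∣X∣≡1) (≤-reflexive (countSubsets-∣∣≡1 n)))
    (≤-trans (≤-reflexive (sym (countSubsets-∣∣≡1 n)))
             (countSubsets≤S 1 λ X ∣X∣≡ᵇ1 →
                let ∣X∣≡1 = ≡ᵇ⇒≡ ∣ X ∣ 1 ∣X∣≡ᵇ1 in singleton-connected ∣X∣≡1 , ∣X∣≡1))

  connected⇒0<S : ∀ {X : Subset n} → T (isConnectedSet G X) → 0 < S G ∣ X ∣
  connected⇒0<S {X} connected = countSubsets-witness {P = λ Y → isConnectedSet G Y ∧ (∣ Y ∣ ≡ᵇ ∣ X ∣)} X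
    (from T-∧ (connected , ≡⇒≡ᵇ ∣ X ∣ ∣ X ∣ refl))

degCS-connected : ∀ G → T (isConnectedSet G ⊤) → degCS G ≡ order G
degCS-connected   (mkGraph zero    _) _         = refl
degCS-connected G@(mkGraph (suc m) _) connected =
  -- here degCS G unfolds to  if S G (suc m) ≡ᵇ 0 then … else suc m
  if-false (0<⇒≢ᵇ0 (subst (λ k → 0 < S G k) (∣⊤∣≡n (suc m)) (connected⇒0<S G {⊤} connected)))
  where
  if-false : ∀ {b} {x y : ℕ} → T (not b) → (if b then x else y) ≡ y
  if-false {false} _ = refl
  0<⇒≢ᵇ0 : ∀ {s} → 0 < s → T (not (s ≡ᵇ 0))
  0<⇒≢ᵇ0 (s≤s _) = _

InducesMatching : (G : Graph) → (Fin (order G) → Set) → Set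
InducesMatching G P = ∀ {a b c} → P a → P b → P c → T (adj G a b) → T (adj G a c) → b ≡ c

-- Every vertex of X other than its least vertex m is a neighbour of m, and m has at most one
-- neighbour in P.
connected-in-matching⇒∣X∣≤2 : ∀ G → Symmetric (λ u v → T (adj G u v)) → ∀ {P} → InducesMatching G P →
                               ∀ X → T (isConnectedSet G X) → (∀ {v} → v ∈ X → P v) → ∣ X ∣ ≤ 2
connected-in-matching⇒∣X∣≤2 G adj-sym matching X connected X⊆P
  with m , least@(m∈X , _) ← connected⇒∃Least G connected =
  ≤-trans (∣p∣≤1+∣p-x∣ X m) (s≤s (subsingleton⇒∣p∣≤1 (X - m) λ x∈X-m y∈X-m →
    matching (X⊆P m∈X) (X⊆P (p─q⊆p X _ x∈X-m)) (X⊆P (p─q⊆p X _ y∈X-m)) (m-adj x∈X-m) (m-adj y∈X-m)))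
  where
  near : ∀ {v} → v ∈ X → v ≡ m ⊎ T (adj G m v)
  near = connected-induction G connected _ (λ least′ → inj₁ (Least-unique least′ least)) closed
    where
    closed : ∀ {u v} → u ∈ X → v ∈ X → u ≡ m ⊎ T (adj G m u) → T (adj G u v) → v ≡ m ⊎ T (adj G m v)
    closed _   _   (inj₁ refl) uv = inj₂ uv
    closed u∈X v∈X (inj₂ mu)   uv = inj₁ (sym (matching (X⊆P u∈X) (X⊆P m∈X) (X⊆P v∈X) (adj-sym mu) uv))
  m-adj : ∀ {v} → v ∈ X - m → T (adj G m v)
  m-adj v∈X-m = fromInj₂ (λ v≡m → contradiction v≡m (x∈p-y⇒x≢y v∈X-m)) (near (p─q⊆p X _ v∈X-m))

module _ (N : ℕ) (es : List (ℕ × ℕ)) where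

  Edge : Fin N → Fin N → Set
  Edge u v = (toℕ u , toℕ v) ∈ₗ es

  edgeAdj⁺ : ∀ {u v} → Edge u v ⊎ Edge v u → T (edgeAdj N es u v)
  edgeAdj⁺ {u} {v} (inj₁ uv) =
    any⁺ _ (lose uv (from T-∨ (inj₁ (from T-∧ (≡⇒≡ᵇ (toℕ u) _ refl , ≡⇒≡ᵇ (toℕ v) _ refl)))))
  edgeAdj⁺ {u} {v} (inj₂ vu) =
    any⁺ _ (lose vu (from T-∨ (inj₂ (from T-∧ (≡⇒≡ᵇ (toℕ v) _ refl , ≡⇒≡ᵇ (toℕ u) _ refl)))))

  edgeAdj⁻ : ∀ {u v} → T (edgeAdj N es u v) → Edge u v ⊎ Edge v u
  edgeAdj⁻ t with (i , j) , ij∈es , hit ← find (any⁻ _ es t) with to T-∨ hit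
  ... | inj₁ hit with i≡u , j≡v ← to T-∧ hit =
    inj₁ (subst₂ (λ i j → (i , j) ∈ₗ es) (≡ᵇ⇒≡ i _ i≡u) (≡ᵇ⇒≡ j _ j≡v) ij∈es)
  ... | inj₂ hit with i≡v , j≡u ← to T-∧ hit =
    inj₂ (subst₂ (λ i j → (i , j) ∈ₗ es) (≡ᵇ⇒≡ i _ i≡v) (≡ᵇ⇒≡ j _ j≡u) ij∈es)

  edgeAdj-sym : Symmetric (λ u v → T (edgeAdj N es u v))
  edgeAdj-sym = edgeAdj⁺ ∘ swap ∘ edgeAdj⁻

  edgeSet : ℕ × ℕ → Subset N
  edgeSet (i , j) = tabulate λ v → (toℕ v ≡ᵇ i) ∨ (toℕ v ≡ᵇ j)

  pair≡edgeSet : ∀ {X : Subset N} {x y} → x ∈ X → y ∈ X → (∀ {z} → z ∈ X → z ≡ x ⊎ z ≡ y) →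
                 X ≡ edgeSet (toℕ x , toℕ y)
  pair≡edgeSet {X} {x} {y} x∈X y∈X x-or-y = ⊆-antisym X⊆edge edge⊆X
    where
    X⊆edge : X ⊆ edgeSet (toℕ x , toℕ y)
    X⊆edge z∈X with x-or-y z∈X
    ... | inj₁ refl = ∈-tabulate⁺ (from T-∨ (inj₁ (≡⇒≡ᵇ (toℕ x) _ refl)))
    ... | inj₂ refl = ∈-tabulate⁺ (from T-∨ (inj₂ (≡⇒≡ᵇ (toℕ y) _ refl)))
    edge⊆X : edgeSet (toℕ x , toℕ y) ⊆ X
    edge⊆X {z} z∈edge with to T-∨ (∈-tabulate⁻ z∈edge)
    ... | inj₁ z≡x = subst (_∈ X) (sym (toℕ-injective (≡ᵇ⇒≡ (toℕ z) _ z≡x))) x∈X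
    ... | inj₂ z≡y = subst (_∈ X) (sym (toℕ-injective (≡ᵇ⇒≡ (toℕ z) _ z≡y))) y∈X

  connected-pair⇒edgeSet : ∀ {X : Subset N} → T (isConnectedSet (fromEdges N es) X) → ∣ X ∣ ≡ 2 →
                           ∃ λ e → e ∈ₗ es × X ≡ edgeSet e
  connected-pair⇒edgeSet connected ∣X∣≡2
    with m , least@(m∈X , _) ← connected⇒∃Least (fromEdges N es) connected
    with b , b∈X , b≢m , m-or-b ← ∣p∣≡2⇒pair ∣X∣≡2 m∈X
    with edgeAdj⁻ (connected-pair⇒adj (fromEdges N es) connected least b∈X b≢m m-or-b)
  ... | inj₁ mb = _ , mb , pair≡edgeSet m∈X b∈X m-or-b
  ... | inj₂ bm = _ , bm , pair≡edgeSet b∈X m∈X (swap ∘ m-or-b)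

  S-two≤length : S (fromEdges N es) 2 ≤ length es
  S-two≤length = ≤-trans (S≤countSubsets (fromEdges N es) 2 {isEdgeSet} pair⇒edge)
    (count-any≤length isEdgeSetOf es (allSubsets N) λ e → ≤-reflexive (countSubsets-≡? (edgeSet e)))
    where
    isEdgeSetOf : Subset N → ℕ × ℕ → Bool
    isEdgeSetOf X e = does (X ≡? edgeSet e)
    isEdgeSet : Subset N → Bool
    isEdgeSet X = any (isEdgeSetOf X) es
    pair⇒edge : ∀ X → T (isConnectedSet (fromEdges N es) X) → ∣ X ∣ ≡ 2 → T (isEdgeSet X)
    pair⇒edge X connected ∣X∣≡2 =
      let e , e∈es , X≡e = connected-pair⇒edgeSet connected ∣X∣≡2
      in any⁺ (isEdgeSetOf X) (lose e∈es (T-does⁺ (X ≡? edgeSet e) X≡e))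

-- The graph B_n

B-centre-adj : ∀ m (u : Fin (suc m)) → u ≢ zero → T (adj (B (suc m)) zero u)
B-centre-adj m zero    u≢0 = contradiction refl u≢0
B-centre-adj m (suc w) _   = edgeAdj⁺ (suc m) (B-edges (suc m))
  (inj₁ (∈-++⁺ˡ (∈-map⁺ (λ i → (0 , suc i)) (∈-upTo⁺ (toℕ<n w)))))

B-containsZero-connected : ∀ n (X : Subset n) → T (containsZero X) → T (isConnectedSet (B n) X)
B-containsZero-connected (suc m) (true ∷ X) _ =
  star-connected (B (suc m)) (here , λ _ → z≤n) (λ {u} _ → B-centre-adj m u)

degCS-B : ∀ n → degCS (B n) ≡ n
degCS-B zero    = refl
degCS-B (suc m) = degCS-connected (B (suc m)) (B-containsZero-connected (suc m) ⊤ _)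

B-containsZero≤S : ∀ n k → countSubsets n (λ X → containsZero X ∧ (∣ X ∣ ≡ᵇ k)) ≤ S (B n) k
B-containsZero≤S n k = countSubsets≤S (B n) k λ X t →
  let ∋0 , ∣X∣≡k = to T-∧ t in B-containsZero-connected n X ∋0 , ≡ᵇ⇒≡ ∣ X ∣ k ∣X∣≡k

module _ (m : ℕ) where

  private
    a b w : Fin (4+ m)
    a = suc zero
    b = suc (suc zero)
    w = suc (suc (suc zero))
    edges-at-c : List (ℕ × ℕ)
    edges-at-c = map (λ i → (0 , suc i)) (upTo (3 + m))

  ab aw : Subset (4+ m)
  ab = false ∷ true ∷ true  ∷ false ∷ ⊥
  aw = false ∷ true ∷ false ∷ true  ∷ ⊥

  ab-connected : T (isConnectedSet (B (4+ m)) ab)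
  ab-connected = edge-connected (B (4+ m)) {ab} {a} {b} (there here) (s≤s z≤n) members
    (edgeAdj⁺ (4+ m) (B-edges (4+ m)) (inj₁ (∈-++⁺ʳ edges-at-c (here refl))))
    where
    members : ∀ {z} → z ∈ ab → z ≡ a ⊎ z ≡ b
    members (there here)                        = inj₁ refl
    members (there (there here))                = inj₂ refl
    members (there (there (there (there z∈⊥)))) = contradiction z∈⊥ ∉⊥

  aw-connected : T (isConnectedSet (B (4+ m)) aw)
  aw-connected = edge-connected (B (4+ m)) {aw} {a} {w} (there here) (s≤s z≤n) members
    (edgeAdj⁺ (4+ m) (B-edges (4+ m)) (inj₁ (∈-++⁺ʳ edges-at-c (there (here refl)))))
    where
    members : ∀ {z} → z ∈ aw → z ≡ a ⊎ z ≡ w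
    members (there here)                        = inj₁ refl
    members (there (there (there here)))        = inj₂ refl
    members (there (there (there (there z∈⊥)))) = contradiction z∈⊥ ∉⊥

B-S-two : ∀ n → 4 ≤ n → suc n ≤ S (B n) 2
B-S-two n@(4+ m) (s≤s (s≤s (s≤s (s≤s _)))) = begin
  suc n
    ≡⟨ sym (trans (+-assoc (3 + m) 1 1) (+-comm (3 + m) 2)) ⟩
  3 + m + 1 + 1
    ≡⟨ sym (cong₂ _+_ (cong₂ _+_ (countSubsets-containsZero∧∣∣≡2 (3 + m)) (countSubsets-≡? (ab m)))
                      (countSubsets-≡? (aw m))) ⟩
  countSubsets n at-c + countSubsets n is-ab + countSubsets n is-aw
    ≤⟨ +-monoˡ-≤ _ (countSubsets-∨-disjoint n {at-c} {is-ab} at-c∩ab=∅) ⟩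
  countSubsets n at-c-or-ab + countSubsets n is-aw
    ≤⟨ countSubsets-∨-disjoint n {at-c-or-ab} {is-aw} at-c-or-ab∩aw=∅ ⟩
  countSubsets n (λ X → at-c-or-ab X ∨ is-aw X)
    ≤⟨ countSubsets≤S (B n) 2 connected-pair ⟩
  S (B n) 2 ∎
  where
  open ≤-Reasoning
  at-c is-ab is-aw at-c-or-ab : Subset n → Bool
  at-c X = containsZero X ∧ (∣ X ∣ ≡ᵇ 2)
  is-ab X = does (X ≡? ab m)
  is-aw X = does (X ≡? aw m)
  at-c-or-ab X = at-c X ∨ is-ab X
  at-c∩ab=∅ : ∀ X → T (at-c X) → T (is-ab X) → Empty.⊥
  at-c∩ab=∅ X at-c-X X≡ab = subst (T ∘ at-c) (T-does⁻ (X ≡? ab m) X≡ab) at-c-X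
  at-c-or-ab∩aw=∅ : ∀ X → T (at-c-or-ab X) → T (is-aw X) → Empty.⊥
  at-c-or-ab∩aw=∅ X at-c-or-ab-X X≡aw = subst (T ∘ at-c-or-ab) (T-does⁻ (X ≡? aw m) X≡aw) at-c-or-ab-X
  equal-to : ∀ X {Y} → T (does (X ≡? Y)) → T (isConnectedSet (B n) Y) → ∣ Y ∣ ≡ 2 →
             T (isConnectedSet (B n) X) × ∣ X ∣ ≡ 2
  equal-to X {Y} X≡Y connected ∣Y∣≡2 =
    subst (λ Z → T (isConnectedSet (B n) Z) × ∣ Z ∣ ≡ 2) (sym (T-does⁻ (X ≡? Y) X≡Y)) (connected , ∣Y∣≡2)
  connected-at-c : ∀ X → T (at-c X) → T (isConnectedSet (B n) X) × ∣ X ∣ ≡ 2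
  connected-at-c X at-c-X = let ∋0 , ∣X∣≡2 = to T-∧ at-c-X in B-containsZero-connected n X ∋0 , ≡ᵇ⇒≡ ∣ X ∣ 2 ∣X∣≡2
  connected-pair : ∀ X → T (at-c-or-ab X ∨ is-aw X) → T (isConnectedSet (B n) X) × ∣ X ∣ ≡ 2
  connected-pair X p =
    [ [ connected-at-c X
      , (λ X≡ab → equal-to X X≡ab (ab-connected m) (cong (2 +_) (∣⊥∣≡0 m))) ]′ ∘ to (T-∨ {at-c X})
    , (λ X≡aw → equal-to X X≡aw (aw-connected m) (cong (2 +_) (∣⊥∣≡0 m))) ]′ (to (T-∨ {at-c-or-ab X}) p)

-- The graph F(n₁,n₂)

halve : ∀ r {n} → r < 2 * n → ∃ λ k → k < n × (r ≡ 2 * k ⊎ r ≡ suc (2 * k))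
halve zero          {suc n} _ = 0 , s≤s z≤n , inj₁ refl
halve (suc zero)    {suc n} _ = 0 , s≤s z≤n , inj₂ refl
halve (suc (suc r)) {suc n} r+2<2+2n
  with k , k<n , r≡ ← halve r {n} (≤-pred (≤-pred (subst (suc (suc r) <_) (*-suc 2 n) r+2<2+2n)))
  = suc k , s≤s k<n , Sum.map (λ r≡2k → trans (cong (2 +_) r≡2k) (sym (*-suc 2 k)))
                              (λ r≡1+2k → trans (cong (2 +_) r≡1+2k) (cong suc (sym (*-suc 2 k)))) r≡

module _ (n₁ n₂ : ℕ) where

  private
    N : ℕ
    N = 5 + n₁ + 2 * n₂
    triangle-edges leaf-edges path-edges : List (ℕ × ℕ)
    triangle-edges = (0 , 1) ∷ (0 , 2) ∷ (1 , 2) ∷ (0 , 3) ∷ (0 , 4) ∷ (3 , 4) ∷ []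
    leaf-edges = map (λ i → (0 , 5 + i)) (upTo n₁)
    path : ℕ → List (ℕ × ℕ)
    path i = (0 , 5 + n₁ + 2 * i) ∷ (5 + n₁ + 2 * i , 6 + n₁ + 2 * i) ∷ []
    path-edges = concatMap path (upTo n₂)

    triangle-edge : ∀ {e} → e ∈ₗ triangle-edges → e ∈ₗ F-edges n₁ n₂
    triangle-edge = ∈-++⁺ˡ {ys = leaf-edges ++ path-edges}

    leaf-edge : ∀ {i} → i < n₁ → (0 , 5 + i) ∈ₗ F-edges n₁ n₂
    leaf-edge i<n₁ =
      ∈-++⁺ʳ triangle-edges (∈-++⁺ˡ {ys = path-edges} (∈-map⁺ (λ i → (0 , 5 + i)) (∈-upTo⁺ i<n₁)))

    path-edge : ∀ {k e} → k < n₂ → e ∈ₗ path k → e ∈ₗ F-edges n₁ n₂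
    path-edge k<n₂ e∈path = ∈-++⁺ʳ triangle-edges (∈-++⁺ʳ leaf-edges
      (∈-concatMap⁺ path {xs = upTo n₂} (lose (∈-upTo⁺ k<n₂) e∈path)))

  F-edges-length : length (F-edges n₁ n₂) ≡ 6 + n₁ + 2 * n₂
  F-edges-length = cong (6 +_) (begin
    length (leaf-edges ++ path-edges)
      ≡⟨ length-++ leaf-edges ⟩
    length leaf-edges + length path-edges
      ≡⟨ cong₂ _+_ (trans (length-map _ (upTo n₁)) (length-upTo n₁))
                   (trans (length-paths (upTo n₂)) (cong (2 *_) (length-upTo n₂))) ⟩
    n₁ + 2 * n₂ ∎)
    where
    open ≡-Reasoning
    length-paths : ∀ is → length (concatMap path is) ≡ 2 * length is
    length-paths []       = refl
    length-paths (i ∷ is) = trans (cong (2 +_) (length-paths is)) (sym (*-suc 2 (length is)))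

  -- the labels of a₁, a₂ and the x_i: every edge of F(n₁,n₂) − z is (i , i + 1) for one of them
  OuterStart : ℕ → Set
  OuterStart i = i ≡ 1 ⊎ i ≡ 3 ⊎ ∃ λ k → i ≡ 5 + n₁ + 2 * k

  OuterStart-no-successor : ∀ {i} → OuterStart i → ¬ OuterStart (suc i)
  OuterStart-no-successor (inj₁ refl)              (inj₂ (inj₂ (k , ())))
  OuterStart-no-successor (inj₂ (inj₁ refl))       (inj₂ (inj₂ (k , ())))
  OuterStart-no-successor (inj₂ (inj₂ (k , refl))) (inj₁ ())
  OuterStart-no-successor (inj₂ (inj₂ (k , refl))) (inj₂ (inj₁ ()))
  OuterStart-no-successor (inj₂ (inj₂ (k , refl))) (inj₂ (inj₂ (k′ , eq))) =
    even≢odd k′ k (+-cancelˡ-≡ (5 + n₁) _ _ (trans (sym eq) (cong (5 +_) (sym (+-suc n₁ (2 * k))))))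

  F-edge-classification : ∀ {i j} → (i , j) ∈ₗ F-edges n₁ n₂ → i ≡ 0 ⊎ (OuterStart i × j ≡ suc i)
  F-edge-classification ij∈ with ∈-++⁻ triangle-edges ij∈
  ... | inj₁ (here refl)                                         = inj₁ refl
  ... | inj₁ (there (here refl))                                 = inj₁ refl
  ... | inj₁ (there (there (here refl)))                         = inj₂ (inj₁ refl , refl)
  ... | inj₁ (there (there (there (here refl))))                 = inj₁ refl
  ... | inj₁ (there (there (there (there (here refl)))))         = inj₁ refl
  ... | inj₁ (there (there (there (there (there (here refl)))))) = inj₂ (inj₂ (inj₁ refl) , refl)
  ... | inj₂ ij∈′ with ∈-++⁻ leaf-edges ij∈′
  ...   | inj₁ ij∈leaf with _ , _ , refl ← ∈-map⁻ _ ij∈leaf = inj₁ refl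
  ...   | inj₂ ij∈paths with k , _ , ij∈path ← find (∈-concatMap⁻ path {xs = upTo n₂} ij∈paths) with ij∈path
  ...     | here refl         = inj₁ refl
  ...     | there (here refl) = inj₂ (inj₂ (inj₂ (k , refl)) , refl)

  outer-edge : ∀ {u v} → u ≢ zero → Edge N (F-edges n₁ n₂) u v → OuterStart (toℕ u) × toℕ v ≡ suc (toℕ u)
  outer-edge u≢0 uv with F-edge-classification uv
  ... | inj₁ u≡0  = contradiction (toℕ-injective u≡0) u≢0
  ... | inj₂ edge = edge

  F-outer-matching : InducesMatching (F n₁ n₂) (_≢ zero)
  F-outer-matching {a} {b} {c} a≢0 b≢0 c≢0 ab ac
    with edgeAdj⁻ N (F-edges n₁ n₂) ab | edgeAdj⁻ N (F-edges n₁ n₂) ac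
  ... | inj₁ a→b | inj₁ a→c =
    toℕ-injective (trans (proj₂ (outer-edge a≢0 a→b)) (sym (proj₂ (outer-edge a≢0 a→c))))
  ... | inj₂ b→a | inj₂ c→a =
    toℕ-injective (suc-injective (trans (sym (proj₂ (outer-edge b≢0 b→a))) (proj₂ (outer-edge c≢0 c→a))))
  ... | inj₁ a→b | inj₂ c→a with c-start , a≡1+c ← outer-edge c≢0 c→a =
    contradiction (subst OuterStart a≡1+c (proj₁ (outer-edge a≢0 a→b))) (OuterStart-no-successor c-start)
  ... | inj₂ b→a | inj₁ a→c with b-start , a≡1+b ← outer-edge b≢0 b→a =
    contradiction (subst OuterStart a≡1+b (proj₁ (outer-edge a≢0 a→c))) (OuterStart-no-successor b-start)

  F-large-connected⇒containsZero : ∀ X → T (isConnectedSet (F n₁ n₂) X) → 2 < ∣ X ∣ → T (containsZero X)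
  F-large-connected⇒containsZero (true  ∷ X) _         _     = _
  F-large-connected⇒containsZero (false ∷ X) connected 2<∣X∣ = contradiction
    (connected-in-matching⇒∣X∣≤2 (F n₁ n₂) (λ {u} {v} → edgeAdj-sym N (F-edges n₁ n₂) {u} {v})
                                  F-outer-matching (false ∷ X) connected avoids-centre)
    (<⇒≱ 2<∣X∣)
    where
    avoids-centre : ∀ {v} → v ∈ false ∷ X → v ≢ zero
    avoids-centre (there _) ()

  F-S≤containsZero : ∀ k → 2 < k →
                     S (F n₁ n₂) k ≤ countSubsets (5 + n₁ + 2 * n₂) (λ X → containsZero X ∧ (∣ X ∣ ≡ᵇ k))
  F-S≤containsZero k 2<k = S≤countSubsets (F n₁ n₂) k λ X connected ∣X∣≡k →
    from T-∧ (F-large-connected⇒containsZero X connected (subst (2 <_) (sym ∣X∣≡k) 2<k) , ≡⇒≡ᵇ ∣ X ∣ k ∣X∣≡k)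

  F-path-label-cases : ∀ r → r < 2 * n₂ →
                       (0 , 5 + n₁ + r) ∈ₗ F-edges n₁ n₂ ⊎ ∃ λ k → k < n₂ × 5 + n₁ + r ≡ 6 + n₁ + 2 * k
  F-path-label-cases r r<2n₂ with halve r {n₂} r<2n₂
  ... | k , k<n₂ , inj₁ refl = inj₁ (path-edge k<n₂ (here refl))
  ... | k , k<n₂ , inj₂ refl = inj₂ (k , k<n₂ , cong (5 +_) (+-suc n₁ (2 * k)))

  F-label-cases : ∀ t → t < N → t ≡ 0 ⊎ (0 , t) ∈ₗ F-edges n₁ n₂ ⊎ ∃ λ k → k < n₂ × t ≡ 6 + n₁ + 2 * k
  F-label-cases 0 _ = inj₁ refl
  F-label-cases 1 _ = inj₂ (inj₁ (triangle-edge (here refl)))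
  F-label-cases 2 _ = inj₂ (inj₁ (triangle-edge (there (here refl))))
  F-label-cases 3 _ = inj₂ (inj₁ (triangle-edge (there (there (there (here refl))))))
  F-label-cases 4 _ = inj₂ (inj₁ (triangle-edge (there (there (there (there (here refl)))))))
  F-label-cases (suc (suc (suc (suc (suc s))))) 5+s<N with s <? n₁
  ... | yes s<n₁ = inj₂ (inj₁ (leaf-edge s<n₁))
  ... | no  s≮n₁ = inj₂ (subst (λ s → (0 , 5 + s) ∈ₗ F-edges n₁ n₂ ⊎ ∃ λ k → k < n₂ × 5 + s ≡ 6 + n₁ + 2 * k)
                               (m+[n∸m]≡n n₁≤s) (F-path-label-cases (s ∸ n₁) r<2n₂))
    where
    n₁≤s : n₁ ≤ s
    n₁≤s = ≮⇒≥ s≮n₁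
    r<2n₂ : s ∸ n₁ < 2 * n₂
    r<2n₂ = +-cancelˡ-< n₁ _ _
      (subst (_< n₁ + 2 * n₂) (sym (m+[n∸m]≡n n₁≤s)) (≤-pred (≤-pred (≤-pred (≤-pred (≤-pred 5+s<N))))))

  F-connected : T (isConnectedSet (F n₁ n₂) ⊤)
  F-connected = depth-two-connected (F n₁ n₂) (s≤s (s≤s z≤n)) {⊤} {zero} (∈⊤ , λ _ → z≤n) near
    where
    centre-adj : ∀ {u} → (0 , toℕ u) ∈ₗ F-edges n₁ n₂ → T (adj (F n₁ n₂) zero u)
    centre-adj 0u∈ = edgeAdj⁺ N (F-edges n₁ n₂) (inj₁ 0u∈)
    near : ∀ {u} → u ∈ ⊤ → u ≡ zero ⊎ T (adj (F n₁ n₂) zero u) ⊎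
                            ∃ λ w → w ∈ ⊤ × T (adj (F n₁ n₂) zero w) × T (adj (F n₁ n₂) w u)
    near {u} _ with F-label-cases (toℕ u) (toℕ<n u)
    ... | inj₁ u≡0                     = inj₁ (toℕ-injective u≡0)
    ... | inj₂ (inj₁ 0u∈)              = inj₂ (inj₁ (centre-adj 0u∈))
    ... | inj₂ (inj₂ (k , k<n₂ , u≡y)) =
      inj₂ (inj₂ (x , ∈⊤ , centre-adj 0x∈ , edgeAdj⁺ N (F-edges n₁ n₂) (inj₁ xu∈)))
      where
      x<N : 5 + n₁ + 2 * k < N
      x<N = <-trans (n<1+n _) (subst (_< N) u≡y (toℕ<n u))
      x : Fin N
      x = fromℕ< x<N
      0x∈ : (0 , toℕ x) ∈ₗ F-edges n₁ n₂
      0x∈ = subst (λ i → (0 , i) ∈ₗ F-edges n₁ n₂) (sym (toℕ-fromℕ< x<N)) (path-edge k<n₂ (here refl))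
      xu∈ : (toℕ x , toℕ u) ∈ₗ F-edges n₁ n₂
      xu∈ = subst₂ (λ i j → (i , j) ∈ₗ F-edges n₁ n₂) (sym (toℕ-fromℕ< x<N)) (sym u≡y)
                   (path-edge k<n₂ (there (here refl)))

F⪯B : ∀ n₁ n₂ → F n₁ n₂ ⪯CS B (5 + n₁ + 2 * n₂)
F⪯B n₁ n₂ = ≤-reflexive degrees , coefficient
  where
  degrees : degCS (F n₁ n₂) ≡ degCS (B (5 + n₁ + 2 * n₂))
  degrees = trans (degCS-connected (F n₁ n₂) (F-connected n₁ n₂)) (sym (degCS-B (5 + n₁ + 2 * n₂)))
  coefficient : ∀ k → S (F n₁ n₂) k ≤ S (B (5 + n₁ + 2 * n₂)) k
  coefficient 0 = ≤-reflexive (trans (S-zero (F n₁ n₂)) (sym (S-zero (B (5 + n₁ + 2 * n₂)))))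
  coefficient 1 = ≤-reflexive (trans (S-one (F n₁ n₂)) (sym (S-one (B (5 + n₁ + 2 * n₂)))))
  coefficient 2 = begin
    S (F n₁ n₂) 2               ≤⟨ S-two≤length (5 + n₁ + 2 * n₂) (F-edges n₁ n₂) ⟩
    length (F-edges n₁ n₂)      ≡⟨ F-edges-length n₁ n₂ ⟩
    6 + n₁ + 2 * n₂             ≤⟨ B-S-two (5 + n₁ + 2 * n₂) (s≤s (s≤s (s≤s (s≤s z≤n)))) ⟩
    S (B (5 + n₁ + 2 * n₂)) 2   ∎
    where open ≤-Reasoning
  coefficient (suc (suc (suc k))) = ≤-trans (F-S≤containsZero n₁ n₂ (3 + k) (s≤s (s≤s (s≤s z≤n))))
                                            (B-containsZero≤S (5 + n₁ + 2 * n₂) (3 + k))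

lemma4p1 : (n n₁ n₂ : ℕ) → 7 ≤ n → n₁ + 2 * n₂ + 5 ≡ n → F n₁ n₂ ⪯CS B n
lemma4p1 n n₁ n₂ _ n₁+2n₂+5≡n =
  subst (λ n → F n₁ n₂ ⪯CS B n) (trans (+-comm 5 (n₁ + 2 * n₂)) n₁+2n₂+5≡n) (F⪯B n₁ n₂)
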